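{- Let $|q|<1$ and $w\in\mathbb{C}$. For nonnegative integers $n,m$, let $\overline{P}(n,m)$ be the number of overpartitions of $n$ in which exactly $m$ positive integers less than the largest part are missing (with $\overline{P}(0,0)=1$). Then \[ \sum_{n=0}^{\infty}\sum_{m=0}^{\infty} \overline{P}(n,m)w^mq^n=\frac{((w-2)q;q)_{\infty}}{(wq;q)_{\infty}}. \]
   Context: An overpartition of $n$ is a partition of $n$ in which the first occurrence of any integer may be overlined. The largest part is the largest integer occurring (overlined or not). A positive integer less than the largest part is missing if it occurs neither overlined nor non-overlined. Notation: $(a;q)_\infty=\prod_{i\ge1}(1-aq^{i-1})$. -}

module Defs where

open import Data.Nat using (ℕ; zero; suc; _+_; _*_; _∸_; _⊔_; _≡ᵇ_; _<ᵇ_)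
open import Data.Bool using (Bool; true; false; if_then_else_; not; _∧_; _∨_; T)
open import Data.Integer using (ℤ; +_; -_) renaming (_+_ to _+ℤ_; _*_ to _*ℤ_)
open import Data.Vec using (Vec; []; _∷_)
open import Data.Product using (Σ; _×_)
open import Relation.Binary.PropositionalEquality using (_≡_)

-- An overpartition of n uses only parts of size 1..n.  It is encoded by
--   cs : Vec ℕ n    -- cs[k-1] = number of occurrences of the part k
--   bs : Vec Bool n -- bs[k-1] = true iff the first occurrence of k is overlined
-- with the constraint that bs[k-1] = true only if cs[k-1] ≥ 1.
-- (A partition is determined by its multiplicities, and an overpartition
-- additionally by which part sizes have their first occurrence overlined.)

weightFrom : ∀ {n} → ℕ → Vec ℕ n → ℕ
weightFrom k []       = 0
weightFrom k (c ∷ cs) = k * c + weightFrom (suc k) cs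

weight : ∀ {n} → Vec ℕ n → ℕ
weight = weightFrom 1

largestFrom : ∀ {n} → ℕ → Vec ℕ n → ℕ
largestFrom k []       = 0
largestFrom k (c ∷ cs) = (if c ≡ᵇ 0 then 0 else k) ⊔ largestFrom (suc k) cs

largest : ∀ {n} → Vec ℕ n → ℕ
largest = largestFrom 1

missingFrom : ∀ {n} → ℕ → ℕ → Vec ℕ n → ℕ
missingFrom L k []       = 0
missingFrom L k (c ∷ cs) =
  (if (k <ᵇ L) ∧ (c ≡ᵇ 0) then 1 else 0) + missingFrom L (suc k) cs

missing : ∀ {n} → Vec ℕ n → ℕ
missing cs = missingFrom (largest cs) 1 cs

overlineValid : ∀ {n} → Vec ℕ n → Vec Bool n → Bool
overlineValid []       []       = true
overlineValid (c ∷ cs) (b ∷ bs) = (not b ∨ not (c ≡ᵇ 0)) ∧ overlineValid cs bs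

record OverPartition (n m : ℕ) : Set where
  constructor overpartition
  field
    mults     : Vec ℕ n
    overlines : Vec Bool n
    valid     : T (overlineValid mults overlines)
    sumIs     : weight mults ≡ n
    missingIs : missing mults ≡ m

-- Formal bivariate power series in q and w with integer coefficients:
-- s n m = coefficient of q^n w^m.

Series : Set
Series = ℕ → ℕ → ℤ

sumTo : ℕ → (ℕ → ℤ) → ℤ
sumTo zero    f = f 0
sumTo (suc n) f = sumTo n f +ℤ f (suc n)

_⊛_ : Series → Series → Series
(f ⊛ g) n m = sumTo n λ i → sumTo m λ j → f i j *ℤ g (n ∸ i) (m ∸ j)

oneS : Series
oneS zero zero = + 1
oneS _    _    = + 0

-- the factor 1 - (w - 2) q^i  =  1 + 2 q^i - w q^i   (for i ≥ 1)
numFactor : ℕ → Series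
numFactor i zero zero = + 1
numFactor i n    zero = if n ≡ᵇ i then + 2 else + 0
numFactor i n    1    = if n ≡ᵇ i then - (+ 1) else + 0
numFactor i n    _    = + 0

-- the factor 1 / (1 - w q^i) = Σ_{k ≥ 0} w^k q^{i k}   (for i ≥ 1)
denFactor : ℕ → Series
denFactor i n m = if n ≡ᵇ i * m then + 1 else + 0

rhsPartial : ℕ → Series
rhsPartial zero    = oneS
rhsPartial (suc N) = rhsPartial N ⊛ (numFactor (suc N) ⊛ denFactor (suc N))

-- An overpartition with exactly N parts is determined by its smallest part s, whether the first s
-- is overlined, and the overpartition with at most N - 1 parts obtained by deleting every copy of s
-- and subtracting s from the remaining parts: it has size n - sN and s - 1 fewer missing integers.
-- Hence the generating function A_N of overpartitions with at most N parts satisfies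
--   A_N = A_{N-1} (1 + Σ_{s ≥ 1} 2 w^{s-1} q^{sN}) = A_{N-1} (1 - (w-2) q^N) / (1 - w q^N),
-- so A_N is the N-th partial product, and an overpartition of n has at most n parts.
module Submission where

open import Defs
open import Data.Bool using (Bool; true; false; T; if_then_else_; not; _∨_)
open import Data.Bool.Properties using (∧-zeroʳ; ∨-zeroʳ; T-∧; T-≡; T-irrelevant; if-float)
open import Data.Empty using (⊥-elim; ⊥-elim-irr)
open import Data.Fin as Fin using (Fin)
open import Data.Fin.Permutation using (↔⇒≡)
open import Data.Fin.Properties using (+↔⊎; *↔×; 2↔Bool)
open import Data.Integer using (ℤ; +_; -_) renaming (_+_ to _+ℤ_; _*_ to _*ℤ_)
import Data.Integer.Properties as ℤ
open import Data.Integer.Tactic.RingSolver using (solve-∀)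
open import Data.Irrelevant using ([_])
open import Data.Maybe using (Maybe; nothing; just)
open import Data.Nat
  using (ℕ; zero; suc; _+_; _*_; _∸_; _⊔_; _≤_; _<_; z≤n; s≤s; s≤s⁻¹; _≤?_; _≟_; _≡ᵇ_; _<ᵇ_)
open import Data.Nat.Properties
import Data.Nat.Tactic.RingSolver as ℕ-Solver
open import Data.Product using (Σ; _×_; _,_; proj₁; proj₂)
open import Data.Product.Function.NonDependent.Propositional using (_×-↔_)
open import Data.Refinement using (Refinement-syntax; _,_; value-injective)
open import Data.Sum using (_⊎_; inj₁; inj₂)
open import Data.Sum.Function.Propositional using (_⊎-↔_)
open import Data.Unit using (tt)
open import Data.Vec using (Vec; []; _∷_)
open import Function using (_∘_)
open import Function.Bundles using (Equivalence; _↔_; mk↔ₛ′)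
open import Function.Properties.Inverse using (↔-trans; ↔-sym)
open import Relation.Binary.PropositionalEquality
open import Relation.Nullary using (¬_; Dec; yes; no; does)
open import Relation.Nullary.Decidable using (recompute)
open import Algebra.Properties.CommutativeSemigroup ℤ.+-commutativeSemigroup using (interchange)

-- Profiles

-- A profile lists, for consecutive part sizes k, k + 1, … up to the largest part, nothing if the size
-- does not occur and just (c , b) if it occurs c + 1 times with its first occurrence overlined iff b;
-- the empty overpartition is nothing : Profile. Having no trailing absent sizes, it is canonical,
-- unlike the multiplicity vectors of OverPartition.
-- The starting size k is not stored: it is the first argument of sizeFrom and largestPartFrom.
Entry : Set
Entry = Maybe (ℕ × Bool)

data Profile⁺ : Set where
  last : ℕ → Bool → Profile⁺
  _∷_  : Entry → Profile⁺ → Profile⁺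

Profile : Set
Profile = Maybe Profile⁺

copies : Entry → ℕ
copies nothing        = 0
copies (just (c , _)) = suc c

overlined : Entry → Bool
overlined nothing        = false
overlined (just (_ , b)) = b

entry : ℕ → Bool → Entry
entry zero    _ = nothing
entry (suc c) b = just (c , b)

parts⁺ : Profile⁺ → ℕ
parts⁺ (last c _) = suc c
parts⁺ (e ∷ x)    = copies e + parts⁺ x

sizeFrom⁺ : ℕ → Profile⁺ → ℕ
sizeFrom⁺ k (last c _) = k * suc c
sizeFrom⁺ k (e ∷ x)    = k * copies e + sizeFrom⁺ (suc k) x

gaps⁺ : Profile⁺ → ℕ
gaps⁺ (last _ _)    = 0
gaps⁺ (nothing ∷ x) = suc (gaps⁺ x)
gaps⁺ (just _ ∷ x)  = gaps⁺ x

largestPartFrom⁺ : ℕ → Profile⁺ → ℕ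
largestPartFrom⁺ k (last _ _) = k
largestPartFrom⁺ k (_ ∷ x)    = largestPartFrom⁺ (suc k) x

parts : Profile → ℕ
parts nothing  = 0
parts (just x) = parts⁺ x

sizeFrom : ℕ → Profile → ℕ
sizeFrom k nothing  = 0
sizeFrom k (just x) = sizeFrom⁺ k x

gaps : Profile → ℕ
gaps nothing  = 0
gaps (just x) = gaps⁺ x

largestPartFrom : ℕ → Profile → ℕ
largestPartFrom k nothing  = 0
largestPartFrom k (just x) = largestPartFrom⁺ k x

cons : Entry → Profile → Profile
cons e              (just x) = just (e ∷ x)
cons nothing        nothing  = nothing
cons (just (c , b)) nothing  = just (last c b)

head : Profile → Entry
head nothing             = nothing
head (just (last c b))   = just (c , b)
head (just (e ∷ _))      = e

tail : Profile → Profile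
tail nothing             = nothing
tail (just (last _ _))   = nothing
tail (just (_ ∷ x))      = just x

cons-head-tail : ∀ t → cons (head t) (tail t) ≡ t
cons-head-tail nothing           = refl
cons-head-tail (just (last _ _)) = refl
cons-head-tail (just (_ ∷ _))    = refl

head-cons : ∀ e t → head (cons e t) ≡ e
head-cons e              (just _) = refl
head-cons nothing        nothing  = refl
head-cons (just (c , b)) nothing  = refl

tail-cons : ∀ e t → tail (cons e t) ≡ t
tail-cons e              (just _) = refl
tail-cons nothing        nothing  = refl
tail-cons (just (c , b)) nothing  = refl

entry-copies-overlined : ∀ e → entry (copies e) (overlined e) ≡ e
entry-copies-overlined nothing        = refl
entry-copies-overlined (just (_ , _)) = refl

copies-entry : ∀ c b → copies (entry c b) ≡ c
copies-entry zero    _ = refl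
copies-entry (suc _) _ = refl

overlined-entry : ∀ c b → T (not b ∨ not (c ≡ᵇ 0)) → overlined (entry c b) ≡ b
overlined-entry zero    false _ = refl
overlined-entry (suc _) _     _ = refl

entry-valid : ∀ e → T (not (overlined e) ∨ not (copies e ≡ᵇ 0))
entry-valid nothing        = tt
entry-valid (just (_ , b)) rewrite ∨-zeroʳ (not b) = tt

fromVecs : ∀ {l} → Vec ℕ l → Vec Bool l → Profile
fromVecs []       []       = nothing
fromVecs (c ∷ cs) (b ∷ bs) = cons (entry c b) (fromVecs cs bs)

multsOf : ∀ l → Profile → Vec ℕ l
multsOf zero    _ = []
multsOf (suc l) t = copies (head t) ∷ multsOf l (tail t)

overlinesOf : ∀ l → Profile → Vec Bool l
overlinesOf zero    _ = []
overlinesOf (suc l) t = overlined (head t) ∷ overlinesOf l (tail t)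

multsOf-fromVecs : ∀ {l} (cs : Vec ℕ l) bs → multsOf l (fromVecs cs bs) ≡ cs
multsOf-fromVecs []       []       = refl
multsOf-fromVecs (c ∷ cs) (b ∷ bs)
  rewrite head-cons (entry c b) (fromVecs cs bs) | tail-cons (entry c b) (fromVecs cs bs)
  = cong₂ _∷_ (copies-entry c b) (multsOf-fromVecs cs bs)

overlinesOf-fromVecs : ∀ {l} (cs : Vec ℕ l) bs → T (overlineValid cs bs) →
                       overlinesOf l (fromVecs cs bs) ≡ bs
overlinesOf-fromVecs []       []       _ = refl
overlinesOf-fromVecs (c ∷ cs) (b ∷ bs) valid
  rewrite head-cons (entry c b) (fromVecs cs bs) | tail-cons (entry c b) (fromVecs cs bs)
  with Equivalence.to T-∧ valid
... | valid-c , valid-cs = cong₂ _∷_ (overlined-entry c b valid-c) (overlinesOf-fromVecs cs bs valid-cs)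

overlineValid-multsOf : ∀ l t → T (overlineValid (multsOf l t) (overlinesOf l t))
overlineValid-multsOf zero    _ = tt
overlineValid-multsOf (suc l) t =
  Equivalence.from T-∧ (entry-valid (head t) , overlineValid-multsOf l (tail t))

largestPartFrom⁺-suc : ∀ k x → largestPartFrom⁺ (suc k) x ≡ suc (largestPartFrom⁺ k x)
largestPartFrom⁺-suc k (last _ _) = refl
largestPartFrom⁺-suc k (_ ∷ x)    = largestPartFrom⁺-suc (suc k) x

largestPartFrom⁺-≥ : ∀ k x → k ≤ largestPartFrom⁺ k x
largestPartFrom⁺-≥ k (last _ _) = ≤-refl
largestPartFrom⁺-≥ k (_ ∷ x)    = ≤-trans (n≤1+n k) (largestPartFrom⁺-≥ (suc k) x)

largestPartFrom-tail : ∀ {l} t → largestPartFrom 1 t ≤ suc l → largestPartFrom 1 (tail t) ≤ l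
largestPartFrom-tail nothing           _ = z≤n
largestPartFrom-tail (just (last _ _)) _ = z≤n
largestPartFrom-tail (just (_ ∷ x))    le rewrite largestPartFrom⁺-suc 1 x = s≤s⁻¹ le

fromVecs-multsOf : ∀ l t → largestPartFrom 1 t ≤ l → fromVecs (multsOf l t) (overlinesOf l t) ≡ t
fromVecs-multsOf zero    nothing  _  = refl
fromVecs-multsOf zero    (just x) le = ⊥-elim (1+n≰n (≤-trans (largestPartFrom⁺-≥ 1 x) le))
fromVecs-multsOf (suc l) t        le = begin
  cons (entry (copies (head t)) (overlined (head t))) (fromVecs (multsOf l (tail t)) (overlinesOf l (tail t)))
    ≡⟨ cong₂ cons (entry-copies-overlined (head t))
                  (fromVecs-multsOf l (tail t) (largestPartFrom-tail t le)) ⟩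
  cons (head t) (tail t)
    ≡⟨ cons-head-tail t ⟩
  t ∎
  where open ≡-Reasoning

sizeFrom-cons : ∀ k c b t → sizeFrom k (cons (entry c b) t) ≡ k * c + sizeFrom (suc k) t
sizeFrom-cons k zero    b nothing  = sym (trans (+-identityʳ (k * 0)) (*-zeroʳ k))
sizeFrom-cons k zero    b (just x) = refl
sizeFrom-cons k (suc c) b nothing  = sym (+-identityʳ (k * suc c))
sizeFrom-cons k (suc c) b (just x) = refl

weightFrom-fromVecs : ∀ k {l} (cs : Vec ℕ l) bs → weightFrom k cs ≡ sizeFrom k (fromVecs cs bs)
weightFrom-fromVecs k []       []       = refl
weightFrom-fromVecs k (c ∷ cs) (b ∷ bs) =
  trans (cong (_+_ (k * c)) (weightFrom-fromVecs (suc k) cs bs)) (sym (sizeFrom-cons k c b (fromVecs cs bs)))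

largestPartFrom-cons : ∀ k c b t →
  largestPartFrom k (cons (entry c b) t) ≡ (if c ≡ᵇ 0 then 0 else k) ⊔ largestPartFrom (suc k) t
largestPartFrom-cons k zero    b nothing  = refl
largestPartFrom-cons k zero    b (just x) = refl
largestPartFrom-cons k (suc c) b nothing  = sym (⊔-identityʳ k)
largestPartFrom-cons k (suc c) b (just x) =
  sym (m≤n⇒m⊔n≡n (≤-trans (n≤1+n k) (largestPartFrom⁺-≥ (suc k) x)))

largestFrom-fromVecs : ∀ k {l} (cs : Vec ℕ l) bs → largestFrom k cs ≡ largestPartFrom k (fromVecs cs bs)
largestFrom-fromVecs k []       []       = refl
largestFrom-fromVecs k (c ∷ cs) (b ∷ bs) =
  trans (cong (_ ⊔_) (largestFrom-fromVecs (suc k) cs bs)) (sym (largestPartFrom-cons k c b (fromVecs cs bs)))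

<ᵇ-false : ∀ {L k} → L ≤ k → (k <ᵇ L) ≡ false
<ᵇ-false z≤n       = refl
<ᵇ-false (s≤s L≤k) = <ᵇ-false L≤k

missingFrom-≤ : ∀ {L k l} (cs : Vec ℕ l) → L ≤ k → missingFrom L k cs ≡ 0
missingFrom-≤ []       _   = refl
missingFrom-≤ {L} {k} (c ∷ cs) L≤k
  rewrite <ᵇ-false L≤k = missingFrom-≤ cs (≤-trans L≤k (n≤1+n k))

missingFrom-fromVecs : ∀ k {l} (cs : Vec ℕ l) bs →
  missingFrom (largestPartFrom k (fromVecs cs bs)) k cs ≡ gaps (fromVecs cs bs)
missingFrom-fromVecs k []       []       = refl
missingFrom-fromVecs k (zero ∷ cs) (b ∷ bs)
  with fromVecs cs bs | missingFrom-fromVecs (suc k) cs bs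
... | nothing | ih = ih
... | just x  | ih rewrite Equivalence.to T-≡ (<⇒<ᵇ (largestPartFrom⁺-≥ (suc k) x)) = cong suc ih
missingFrom-fromVecs k (suc c ∷ cs) (b ∷ bs)
  with fromVecs cs bs | missingFrom-fromVecs (suc k) cs bs
... | nothing | _  rewrite ∧-zeroʳ (k <ᵇ k) = missingFrom-≤ cs (n≤1+n k)
... | just x  | ih rewrite ∧-zeroʳ (k <ᵇ largestPartFrom⁺ (suc k) x) = ih

sizeFrom⁺-+ : ∀ j k x → sizeFrom⁺ (j + k) x ≡ k * parts⁺ x + sizeFrom⁺ j x
sizeFrom⁺-+ j k (last c _) = trans (*-distribʳ-+ (suc c) j k) (+-comm (j * suc c) (k * suc c))
sizeFrom⁺-+ j k (e ∷ x)    =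
  trans (cong (_+_ ((j + k) * copies e)) (sizeFrom⁺-+ (suc j) k x))
        (regroup j k (copies e) (parts⁺ x) (sizeFrom⁺ (suc j) x))
  where
  regroup : ∀ j k c p s → (j + k) * c + (k * p + s) ≡ k * (c + p) + (j * c + s)
  regroup = ℕ-Solver.solve-∀

parts⁺≤sizeFrom⁺ : ∀ k x → parts⁺ x ≤ sizeFrom⁺ (suc k) x
parts⁺≤sizeFrom⁺ k (last c _) = m≤m+n (suc c) (k * suc c)
parts⁺≤sizeFrom⁺ k (e ∷ x)    =
  +-mono-≤ (m≤m+n (copies e) (k * copies e)) (parts⁺≤sizeFrom⁺ (suc k) x)

largestPartFrom⁺≤sizeFrom⁺ : ∀ k x → largestPartFrom⁺ k x ≤ sizeFrom⁺ k x
largestPartFrom⁺≤sizeFrom⁺ k (last c _) = m≤m*n k (suc c)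
largestPartFrom⁺≤sizeFrom⁺ k (e ∷ x)    =
  ≤-trans (largestPartFrom⁺≤sizeFrom⁺ (suc k) x) (m≤n+m (sizeFrom⁺ (suc k) x) (k * copies e))

0<parts⁺ : ∀ x → 0 < parts⁺ x
0<parts⁺ (last _ _) = s≤s z≤n
0<parts⁺ (e ∷ x)    = ≤-trans (0<parts⁺ x) (m≤n+m (parts⁺ x) (copies e))

parts≤sizeFrom : ∀ t → parts t ≤ sizeFrom 1 t
parts≤sizeFrom nothing  = z≤n
parts≤sizeFrom (just x) = parts⁺≤sizeFrom⁺ 0 x

largestPartFrom≤sizeFrom : ∀ t → largestPartFrom 1 t ≤ sizeFrom 1 t
largestPartFrom≤sizeFrom nothing  = z≤n
largestPartFrom≤sizeFrom (just x) = largestPartFrom⁺≤sizeFrom⁺ 1 x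

missing-fromVecs : ∀ {l} (cs : Vec ℕ l) bs → missing cs ≡ gaps (fromVecs cs bs)
missing-fromVecs cs bs =
  trans (cong (λ L → missingFrom L 1 cs) (largestFrom-fromVecs 1 cs bs)) (missingFrom-fromVecs 1 cs bs)

AtMost : ℕ → ℕ → ℕ → Set
AtMost N n m = [ t ∈ Profile ∣ parts t ≤ N × sizeFrom 1 t ≡ n × gaps t ≡ m ]

OverPartition-≡ : ∀ {n m} {p q : OverPartition n m} →
                  OverPartition.mults p ≡ OverPartition.mults q →
                  OverPartition.overlines p ≡ OverPartition.overlines q → p ≡ q
OverPartition-≡ {p = overpartition _ _ v s d} {overpartition _ _ v′ s′ d′} refl refl
  rewrite T-irrelevant v v′ | ≡-irrelevant s s′ | ≡-irrelevant d d′ = refl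

OverPartition↔AtMost : ∀ {N n m} → n ≤ N → OverPartition n m ↔ AtMost N n m
OverPartition↔AtMost {N} {n} {m} n≤N = mk↔ₛ′ encode decode encode-decode decode-encode
  where
  encode : OverPartition n m → AtMost N n m
  encode (overpartition cs bs _ sumIs missingIs) = t , [ parts-t≤N , size-t , gaps-t ]
    where
    t = fromVecs cs bs
    size-t : sizeFrom 1 t ≡ n
    size-t = trans (sym (weightFrom-fromVecs 1 cs bs)) sumIs
    parts-t≤N : parts t ≤ N
    parts-t≤N = ≤-trans (parts≤sizeFrom t) (≤-trans (≤-reflexive size-t) n≤N)
    gaps-t : gaps t ≡ m
    gaps-t = trans (sym (missing-fromVecs cs bs)) missingIs

  fits : ∀ t → .(sizeFrom 1 t ≡ n) → fromVecs (multsOf n t) (overlinesOf n t) ≡ t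
  fits t size-t = fromVecs-multsOf n t
    (≤-trans (largestPartFrom≤sizeFrom t) (≤-reflexive (recompute (_ ≟ _) size-t)))

  decode : AtMost N n m → OverPartition n m
  decode (t , [ h ]) =
    overpartition (multsOf n t) (overlinesOf n t) (overlineValid-multsOf n t)
      (trans (weightFrom-fromVecs 1 (multsOf n t) (overlinesOf n t))
        (trans (cong (sizeFrom 1) (fits t (proj₁ (proj₂ h)))) (recompute (_ ≟ _) (proj₁ (proj₂ h)))))
      (trans (missing-fromVecs (multsOf n t) (overlinesOf n t))
        (trans (cong gaps (fits t (proj₁ (proj₂ h)))) (recompute (_ ≟ _) (proj₂ (proj₂ h)))))

  encode-decode : ∀ t → encode (decode t) ≡ t
  encode-decode (t , [ h ]) = value-injective (fits t (proj₁ (proj₂ h)))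

  decode-encode : ∀ p → decode (encode p) ≡ p
  decode-encode (overpartition cs bs valid _ _) =
    OverPartition-≡ (multsOf-fromVecs cs bs) (overlinesOf-fromVecs cs bs valid)

-- Counting profiles by their number of parts

-- Profiles read from part size k with exactly N′ + 1 parts (gaps below k are not counted).
-- Their first entry is either absent (a leading gap) or the smallest part k, and deleting all
-- copies of k and subtracting k from the other parts leaves a Stripped profile.
Exactly : ℕ → ℕ → ℕ → ℕ → Set
Exactly N′ k n m = [ x ∈ Profile⁺ ∣ parts⁺ x ≡ suc N′ × sizeFrom⁺ k x ≡ n × gaps⁺ x ≡ m ]

LeadingGap : ℕ → ℕ → ℕ → ℕ → Set
LeadingGap N′ k n m =
  [ x ∈ Profile⁺ ∣ parts⁺ x ≡ suc N′ × sizeFrom⁺ (suc k) x ≡ n × suc (gaps⁺ x) ≡ m ]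

Stripped : ℕ → ℕ → ℕ → ℕ → Set
Stripped N′ k n m = [ t ∈ Profile ∣ parts t ≤ N′ × k * suc N′ + sizeFrom 1 t ≡ n × gaps t ≡ m ]

sizeFrom⁺-strip : ∀ k c x → k * c + sizeFrom⁺ (suc k) x ≡ k * (c + parts⁺ x) + sizeFrom⁺ 1 x
sizeFrom⁺-strip k c x = begin
  k * c + sizeFrom⁺ (suc k) x             ≡⟨ cong (_+_ (k * c)) (sizeFrom⁺-+ 1 k x) ⟩
  k * c + (k * parts⁺ x + sizeFrom⁺ 1 x)  ≡⟨ +-assoc (k * c) _ _ ⟨
  k * c + k * parts⁺ x + sizeFrom⁺ 1 x    ≡⟨ cong (_+ sizeFrom⁺ 1 x) (*-distribˡ-+ k c (parts⁺ x)) ⟨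
  k * (c + parts⁺ x) + sizeFrom⁺ 1 x      ∎
  where open ≡-Reasoning

AtMost-suc : ∀ N′ n m → AtMost (suc N′) n m ↔ (AtMost N′ n m ⊎ Exactly N′ 1 n m)
AtMost-suc N′ n m = mk↔ₛ′ split join split-join join-split
  where
  split : AtMost (suc N′) n m → AtMost N′ n m ⊎ Exactly N′ 1 n m
  split (nothing , [ h ]) = inj₁ (nothing , [ z≤n , proj₂ h ])
  split (just x  , [ h ]) with parts⁺ x ≤? N′
  ... | yes x≤N′ = inj₁ (just x , [ x≤N′ , proj₂ h ])
  ... | no  x≰N′ = inj₂ (x , [ ≤-antisym (proj₁ h) (≰⇒> x≰N′) , proj₂ h ])

  join : AtMost N′ n m ⊎ Exactly N′ 1 n m → AtMost (suc N′) n m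
  join (inj₁ (t , [ h ])) = t , [ m≤n⇒m≤1+n (proj₁ h) , proj₂ h ]
  join (inj₂ (x , [ h ])) = just x , [ ≤-reflexive (proj₁ h) , proj₂ h ]

  split-join : ∀ u → split (join u) ≡ u
  split-join (inj₁ (nothing , _)) = refl
  split-join (inj₁ (just x , [ h ])) with parts⁺ x ≤? N′
  ... | yes _    = refl
  ... | no  x≰N′ = ⊥-elim-irr (x≰N′ (proj₁ h))
  split-join (inj₂ (x , [ h ])) with parts⁺ x ≤? N′
  ... | yes x≤N′ = ⊥-elim-irr (1+n≰n (subst (_≤ N′) (proj₁ h) x≤N′))
  ... | no  _    = refl

  join-split : ∀ t → join (split t) ≡ t
  join-split (nothing , _) = refl
  join-split (just x , _) with parts⁺ x ≤? N′
  ... | yes _ = refl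
  ... | no  _ = refl

Exactly-split : ∀ N′ k n m → Exactly N′ k n m ↔ (LeadingGap N′ k n m ⊎ (Bool × Stripped N′ k n m))
Exactly-split N′ k n m = mk↔ₛ′ split join split-join join-split
  where
  absent-size : ∀ x → k * 0 + sizeFrom⁺ (suc k) x ≡ sizeFrom⁺ (suc k) x
  absent-size x = cong (_+ sizeFrom⁺ (suc k) x) (*-zeroʳ k)

  strip-size : ∀ c x → suc c + parts⁺ x ≡ suc N′ →
               k * suc c + sizeFrom⁺ (suc k) x ≡ k * suc N′ + sizeFrom⁺ 1 x
  strip-size c x c+p≡N = trans (sizeFrom⁺-strip k (suc c) x) (cong (λ p → k * p + sizeFrom⁺ 1 x) c+p≡N)

  split : Exactly N′ k n m → LeadingGap N′ k n m ⊎ (Bool × Stripped N′ k n m)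
  split (nothing ∷ x , [ h ]) =
    inj₁ (x , [ proj₁ h , trans (sym (absent-size x)) (proj₁ (proj₂ h)) , proj₂ (proj₂ h) ])
  split (just (c , b) ∷ x , [ h ]) =
    inj₂ (b , just x , [ subst (parts⁺ x ≤_) (suc-injective (proj₁ h)) (m≤n+m (parts⁺ x) c)
                       , trans (sym (strip-size c x (proj₁ h))) (proj₁ (proj₂ h))
                       , proj₂ (proj₂ h) ])
  split (last c b , [ h ]) =
    inj₂ (b , nothing , [ z≤n
                        , trans (+-identityʳ _) (trans (cong (k *_) (sym (proj₁ h))) (proj₁ (proj₂ h)))
                        , proj₂ (proj₂ h) ])

  join : LeadingGap N′ k n m ⊎ (Bool × Stripped N′ k n m) → Exactly N′ k n m
  join (inj₁ (x , [ h ])) =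
    nothing ∷ x , [ proj₁ h , trans (absent-size x) (proj₁ (proj₂ h)) , proj₂ (proj₂ h) ]
  join (inj₂ (b , nothing , [ h ])) =
    last N′ b , [ refl , trans (sym (+-identityʳ _)) (proj₁ (proj₂ h)) , proj₂ (proj₂ h) ]
  join (inj₂ (b , just x , [ h ])) =
    just (N′ ∸ parts⁺ x , b) ∷ x , [ cong suc (m∸n+n≡m (proj₁ h))
                                   , trans (strip-size (N′ ∸ parts⁺ x) x (cong suc (m∸n+n≡m (proj₁ h))))
                                           (proj₁ (proj₂ h))
                                   , proj₂ (proj₂ h) ]

  split-join : ∀ u → split (join u) ≡ u
  split-join (inj₁ _)                 = refl
  split-join (inj₂ (_ , nothing , _)) = refl
  split-join (inj₂ (_ , just _ , _))  = refl

  join-split : ∀ x → join (split x) ≡ x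
  join-split (nothing ∷ _ , _)          = refl
  join-split (just (c , b) ∷ x , [ h ]) = value-injective (cong (λ c → just (c , b) ∷ x) N′∸p≡c)
    where
    N′∸p≡c : N′ ∸ parts⁺ x ≡ c
    N′∸p≡c = trans (cong (_∸ parts⁺ x) (suc-injective (sym (recompute (_ ≟ _) (proj₁ h)))))
                   (m+n∸n≡m c (parts⁺ x))
  join-split (last c b , [ h ])         =
    value-injective (cong (λ c → last c b) (suc-injective (sym (recompute (_ ≟ _) (proj₁ h)))))

LeadingGap-zero : ∀ N′ k n → ¬ LeadingGap N′ k n 0
LeadingGap-zero N′ k n (x , [ h ]) = ⊥-elim-irr (1+n≢0 (proj₂ (proj₂ h)))

LeadingGap-suc : ∀ N′ k n m → LeadingGap N′ k n (suc m) ↔ Exactly N′ (suc k) n m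
LeadingGap-suc N′ k n m = mk↔ₛ′
  (λ { (x , [ h ]) → x , [ proj₁ h , proj₁ (proj₂ h) , suc-injective (proj₂ (proj₂ h)) ] })
  (λ { (x , [ h ]) → x , [ proj₁ h , proj₁ (proj₂ h) , cong suc (proj₂ (proj₂ h)) ] })
  (λ _ → refl) (λ _ → refl)

Stripped-≤ : ∀ N′ k n m → k * suc N′ ≤ n → Stripped N′ k n m ↔ AtMost N′ (n ∸ k * suc N′) m
Stripped-≤ N′ k n m d≤n = mk↔ₛ′
  (λ { (t , [ h ]) → t , [ proj₁ h , sym (m+n≡o⇒o∸m≡n (proj₁ (proj₂ h))) , proj₂ (proj₂ h) ] })
  (λ { (t , [ h ]) → t , [ proj₁ h
                          , trans (cong (_+_ (k * suc N′)) (proj₁ (proj₂ h))) (m+[n∸m]≡n d≤n)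
                          , proj₂ (proj₂ h) ] })
  (λ _ → refl) (λ _ → refl)
  where
  m+n≡o⇒o∸m≡n : ∀ {d s} → d + s ≡ n → n ∸ d ≡ s
  m+n≡o⇒o∸m≡n {d} {s} refl = m+n∸m≡n d s

Stripped-≰ : ∀ N′ k n m → ¬ (k * suc N′ ≤ n) → ¬ Stripped N′ k n m
Stripped-≰ N′ k n m d≰n (t , [ h ]) =
  ⊥-elim-irr (d≰n (subst (k * suc N′ ≤_) (proj₁ (proj₂ h)) (m≤m+n (k * suc N′) (sizeFrom 1 t))))

¬A⇒A↔Fin0 : ∀ {A : Set} → ¬ A → A ↔ Fin 0
¬A⇒A↔Fin0 ¬a = mk↔ₛ′ (λ a → ⊥-elim (¬a a)) (λ ()) (λ ()) (λ a → ⊥-elim (¬a a))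

countStripped : (ℕ → ℕ → ℕ) → ℕ → ℕ → ℕ → ℕ → ℕ
countStripped count N′ k n m = if does (k * suc N′ ≤? n) then 2 * count (n ∸ k * suc N′) m else 0

countExactly : (ℕ → ℕ → ℕ) → ℕ → ℕ → ℕ → ℕ → ℕ
countExactly count N′ k n zero    = countStripped count N′ k n zero
countExactly count N′ k n (suc m) = countExactly count N′ (suc k) n m + countStripped count N′ k n (suc m)

countAtMost : ℕ → ℕ → ℕ → ℕ
countAtMost zero     zero    zero    = 1
countAtMost zero     _       _       = 0
countAtMost (suc N′) n       m       = countAtMost N′ n m + countExactly (countAtMost N′) N′ 1 n m

module _ (N′ : ℕ) (count : ℕ → ℕ → ℕ)
         (AtMost↔Fin : ∀ n m → AtMost N′ n m ↔ Fin (count n m)) where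

  Bool×Stripped↔Fin : ∀ k n m → (Bool × Stripped N′ k n m) ↔ Fin (countStripped count N′ k n m)
  Bool×Stripped↔Fin k n m = by-cases (k * suc N′ ≤? n)
    where
    by-cases : (d : Dec (k * suc N′ ≤ n)) →
               (Bool × Stripped N′ k n m) ↔ Fin (if does d then 2 * count (n ∸ k * suc N′) m else 0)
    by-cases (yes d≤n) =
      ↔-trans (↔-sym 2↔Bool ×-↔ ↔-trans (Stripped-≤ N′ k n m d≤n) (AtMost↔Fin _ m)) (↔-sym *↔×)
    by-cases (no  d≰n) = ¬A⇒A↔Fin0 (λ (_ , s) → Stripped-≰ N′ k n m d≰n s)

  Exactly↔Fin : ∀ k n m → Exactly N′ k n m ↔ Fin (countExactly count N′ k n m)
  Exactly↔Fin k n zero    = ↔-trans (Exactly-split N′ k n zero)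
    (↔-trans (¬A⇒A↔Fin0 (LeadingGap-zero N′ k n) ⊎-↔ Bool×Stripped↔Fin k n zero) (↔-sym +↔⊎))
  Exactly↔Fin k n (suc m) = ↔-trans (Exactly-split N′ k n (suc m))
    (↔-trans (↔-trans (LeadingGap-suc N′ k n m) (Exactly↔Fin (suc k) n m)
                ⊎-↔ Bool×Stripped↔Fin k n (suc m))
             (↔-sym +↔⊎))

AtMost-zero↔Fin : ∀ n m → AtMost 0 n m ↔ Fin (countAtMost 0 n m)
AtMost-zero↔Fin zero zero = mk↔ₛ′ (λ _ → Fin.zero) (λ _ → nothing , [ z≤n , refl , refl ])
  (λ { Fin.zero → refl ; (Fin.suc ()) })
  (λ { (nothing , _) → refl ; (just x , [ h ]) → ⊥-elim-irr (<⇒≱ (0<parts⁺ x) (proj₁ h)) })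
AtMost-zero↔Fin zero (suc m) = ¬A⇒A↔Fin0 λ
  { (nothing , [ h ]) → ⊥-elim-irr (1+n≢0 (sym (proj₂ (proj₂ h))))
  ; (just x , [ h ])  → ⊥-elim-irr (<⇒≱ (0<parts⁺ x) (proj₁ h)) }
AtMost-zero↔Fin (suc n) m = ¬A⇒A↔Fin0 λ
  { (nothing , [ h ]) → ⊥-elim-irr (1+n≢0 (sym (proj₁ (proj₂ h))))
  ; (just x , [ h ])  → ⊥-elim-irr (<⇒≱ (0<parts⁺ x) (proj₁ h)) }

AtMost↔Fin : ∀ N n m → AtMost N n m ↔ Fin (countAtMost N n m)
AtMost↔Fin zero     n m = AtMost-zero↔Fin n m
AtMost↔Fin (suc N′) n m = ↔-trans (AtMost-suc N′ n m)
  (↔-trans (AtMost↔Fin N′ n m ⊎-↔ Exactly↔Fin N′ (countAtMost N′) (AtMost↔Fin N′) 1 n m)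
           (↔-sym +↔⊎))


≡ᵇ-refl : ∀ n → (n ≡ᵇ n) ≡ true
≡ᵇ-refl n = Equivalence.to T-≡ (≡⇒≡ᵇ n n refl)

≢⇒≡ᵇ-false : ∀ {m n} → m ≢ n → (m ≡ᵇ n) ≡ false
≢⇒≡ᵇ-false {zero}  {zero}  m≢n = ⊥-elim (m≢n refl)
≢⇒≡ᵇ-false {zero}  {suc n} _   = refl
≢⇒≡ᵇ-false {suc m} {zero}  _   = refl
≢⇒≡ᵇ-false {suc m} {suc n} m≢n = ≢⇒≡ᵇ-false (m≢n ∘ cong suc)

+-≡ᵇ : ∀ p m n → (p + m ≡ᵇ p + n) ≡ (m ≡ᵇ n)
+-≡ᵇ zero    m n = refl
+-≡ᵇ (suc p) m n = +-≡ᵇ p m n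

sumTo-cong : ∀ n {f g : ℕ → ℤ} → (∀ i → i ≤ n → f i ≡ g i) → sumTo n f ≡ sumTo n g
sumTo-cong zero    f≗g = f≗g 0 z≤n
sumTo-cong (suc n) f≗g =
  cong₂ _+ℤ_ (sumTo-cong n (λ i i≤n → f≗g i (m≤n⇒m≤1+n i≤n))) (f≗g (suc n) ≤-refl)

sumTo-+ : ∀ n (f g : ℕ → ℤ) → sumTo n (λ i → f i +ℤ g i) ≡ sumTo n f +ℤ sumTo n g
sumTo-+ zero    f g = refl
sumTo-+ (suc n) f g =
  trans (cong (_+ℤ (f (suc n) +ℤ g (suc n))) (sumTo-+ n f g))
        (interchange (sumTo n f) (sumTo n g) (f (suc n)) (g (suc n)))

sumTo-zero : ∀ n {f : ℕ → ℤ} → (∀ i → i ≤ n → f i ≡ + 0) → sumTo n f ≡ + 0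
sumTo-zero zero    f≡0 = f≡0 0 z≤n
sumTo-zero (suc n) f≡0 =
  cong₂ _+ℤ_ (sumTo-zero n (λ i i≤n → f≡0 i (m≤n⇒m≤1+n i≤n))) (f≡0 (suc n) ≤-refl)

sumTo-single : ∀ n {a} {f : ℕ → ℤ} → a ≤ n → (∀ i → i ≤ n → i ≢ a → f i ≡ + 0) →
               sumTo n f ≡ f a
sumTo-single zero    z≤n _ = refl
sumTo-single (suc n) {a} {f} a≤1+n f≡0 with a ≟ suc n
... | yes refl = trans
  (cong (_+ℤ f (suc n)) (sumTo-zero n λ i i≤n → f≡0 i (m≤n⇒m≤1+n i≤n) (<⇒≢ (s≤s i≤n))))
  (ℤ.+-identityˡ (f (suc n)))
... | no  a≢1+n = trans
  (cong₂ _+ℤ_ (sumTo-single n (s≤s⁻¹ (≤∧≢⇒< a≤1+n a≢1+n)) λ i i≤n → f≡0 i (m≤n⇒m≤1+n i≤n))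
              (f≡0 (suc n) ≤-refl (a≢1+n ∘ sym)))
  (ℤ.+-identityʳ (f a))

sumTo-swap : ∀ n m (h : ℕ → ℕ → ℤ) →
             sumTo n (λ i → sumTo m (h i)) ≡ sumTo m (λ j → sumTo n (λ i → h i j))
sumTo-swap zero    m h = refl
sumTo-swap (suc n) m h =
  trans (cong (_+ℤ sumTo m (h (suc n))) (sumTo-swap n m h))
        (sym (sumTo-+ m (λ j → sumTo n (λ i → h i j)) (h (suc n))))

infix 4 _≐_
_≐_ : Series → Series → Set
f ≐ g = ∀ n m → f n m ≡ g n m

infixl 6 _⊕_
_⊕_ : Series → Series → Series
(f ⊕ g) n m = f n m +ℤ g n m

⊛-congˡ : ∀ {f f′} g → f ≐ f′ → f ⊛ g ≐ f′ ⊛ g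
⊛-congˡ g f≐f′ n m =
  sumTo-cong n λ i _ → sumTo-cong m λ j _ → cong (_*ℤ g (n ∸ i) (m ∸ j)) (f≐f′ i j)

⊛-congʳ : ∀ f {g g′} → g ≐ g′ → f ⊛ g ≐ f ⊛ g′
⊛-congʳ f g≐g′ n m =
  sumTo-cong n λ i _ → sumTo-cong m λ j _ → cong (f i j *ℤ_) (g≐g′ (n ∸ i) (m ∸ j))

⊛-distribʳ-⊕ : ∀ h f g → (f ⊕ g) ⊛ h ≐ (f ⊛ h) ⊕ (g ⊛ h)
⊛-distribʳ-⊕ h f g n m =
  trans (sumTo-cong n λ i _ →
           trans (sumTo-cong m λ j _ → ℤ.*-distribʳ-+ (h (n ∸ i) (m ∸ j)) (f i j) (g i j))
                 (sumTo-+ m _ _))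
        (sumTo-+ n _ _)

⊛-distribˡ-⊕ : ∀ f g h → f ⊛ (g ⊕ h) ≐ (f ⊛ g) ⊕ (f ⊛ h)
⊛-distribˡ-⊕ f g h n m =
  trans (sumTo-cong n λ i _ →
           trans (sumTo-cong m λ j _ → ℤ.*-distribˡ-+ (f i j) (g (n ∸ i) (m ∸ j)) (h (n ∸ i) (m ∸ j)))
                 (sumTo-+ m _ _))
        (sumTo-+ n _ _)

oneS-∸ˡ : ∀ {i n} b → i < n → oneS (n ∸ i) b ≡ + 0
oneS-∸ˡ {i} {n} b i<n with n ∸ i | m<n⇒0<n∸m i<n
... | suc _ | _ = refl

oneS-∸ʳ : ∀ {j m} → j < m → oneS 0 (m ∸ j) ≡ + 0
oneS-∸ʳ {j} {m} j<m with m ∸ j | m<n⇒0<n∸m j<m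
... | suc _ | _ = refl

⊛-identityʳ : ∀ f → f ⊛ oneS ≐ f
⊛-identityʳ f n m = begin
  (f ⊛ oneS) n m
    ≡⟨ sumTo-single n ≤-refl (λ i i≤n i≢n → sumTo-zero m λ j _ →
         trans (cong (f i j *ℤ_) (oneS-∸ˡ (m ∸ j) (≤∧≢⇒< i≤n i≢n))) (ℤ.*-zeroʳ (f i j))) ⟩
  sumTo m (λ j → f n j *ℤ oneS (n ∸ n) (m ∸ j))
    ≡⟨ cong (λ z → sumTo m (λ j → f n j *ℤ oneS z (m ∸ j))) (n∸n≡0 n) ⟩
  sumTo m (λ j → f n j *ℤ oneS 0 (m ∸ j))
    ≡⟨ sumTo-single m ≤-refl (λ j j≤m j≢m →
         trans (cong (f n j *ℤ_) (oneS-∸ʳ (≤∧≢⇒< j≤m j≢m))) (ℤ.*-zeroʳ (f n j))) ⟩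
  f n m *ℤ oneS 0 (m ∸ m)
    ≡⟨ cong (λ z → f n m *ℤ oneS 0 z) (n∸n≡0 m) ⟩
  f n m *ℤ + 1
    ≡⟨ ℤ.*-identityʳ (f n m) ⟩
  f n m ∎
  where open ≡-Reasoning

-- monomial p e c is c q^p w^e, and shift p e f is q^p w^e f.
monomial : ℕ → ℕ → ℤ → Series
monomial p e c i j = if i ≡ᵇ p then (if j ≡ᵇ e then c else + 0) else + 0

shift : ℕ → ℕ → Series → Series
shift p e f a b with p ≤? a | e ≤? b
... | yes _ | yes _ = f (a ∸ p) (b ∸ e)
... | _     | _     = + 0

monomial-offˡ : ∀ {p e c} i j → i ≢ p → monomial p e c i j ≡ + 0
monomial-offˡ i j i≢p rewrite ≢⇒≡ᵇ-false i≢p = refl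

monomial-offʳ : ∀ {p e c} i j → j ≢ e → monomial p e c i j ≡ + 0
monomial-offʳ {p} i j j≢e with i ≡ᵇ p
... | true  rewrite ≢⇒≡ᵇ-false j≢e = refl
... | false = refl

monomial-at : ∀ p e c → monomial p e c p e ≡ c
monomial-at p e c rewrite ≡ᵇ-refl p | ≡ᵇ-refl e = refl

monomial-⊛ : ∀ p e c g a b → (monomial p e c ⊛ g) a b ≡ c *ℤ shift p e g a b
monomial-⊛ p e c g a b with p ≤? a | e ≤? b
... | no p≰a | _ = trans
  (sumTo-zero a λ i i≤a → sumTo-zero b λ j _ →
     cong (_*ℤ g (a ∸ i) (b ∸ j)) (monomial-offˡ i j λ { refl → p≰a i≤a }))
  (sym (ℤ.*-zeroʳ c))
... | yes _ | no e≰b = trans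
  (sumTo-zero a λ i _ → sumTo-zero b λ j j≤b →
     cong (_*ℤ g (a ∸ i) (b ∸ j)) (monomial-offʳ i j λ { refl → e≰b j≤b }))
  (sym (ℤ.*-zeroʳ c))
... | yes p≤a | yes e≤b = begin
  sumTo a (λ i → sumTo b λ j → monomial p e c i j *ℤ g (a ∸ i) (b ∸ j))
    ≡⟨ sumTo-single a p≤a (λ i _ i≢p → sumTo-zero b λ j _ →
         cong (_*ℤ g (a ∸ i) (b ∸ j)) (monomial-offˡ i j i≢p)) ⟩
  sumTo b (λ j → monomial p e c p j *ℤ g (a ∸ p) (b ∸ j))
    ≡⟨ sumTo-single b e≤b (λ j _ j≢e → cong (_*ℤ g (a ∸ p) (b ∸ j)) (monomial-offʳ p j j≢e)) ⟩
  monomial p e c p e *ℤ g (a ∸ p) (b ∸ e)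
    ≡⟨ cong (_*ℤ g (a ∸ p) (b ∸ e)) (monomial-at p e c) ⟩
  c *ℤ g (a ∸ p) (b ∸ e) ∎
  where open ≡-Reasoning

numFactor-monomials : ∀ N′ →
  numFactor (suc N′) ≐ monomial 0 0 (+ 1) ⊕ monomial (suc N′) 0 (+ 2) ⊕ monomial (suc N′) 1 (- + 1)
numFactor-monomials N′ zero    zero          = refl
numFactor-monomials N′ zero    (suc zero)    = refl
numFactor-monomials N′ zero    (suc (suc _)) = refl
numFactor-monomials N′ (suc a) zero with a ≡ᵇ N′
... | true  = refl
... | false = refl
numFactor-monomials N′ (suc a) (suc zero) with a ≡ᵇ N′
... | true  = refl
... | false = refl
numFactor-monomials N′ (suc a) (suc (suc _)) with a ≡ᵇ N′
... | true  = refl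
... | false = refl

-- 2 q^M / (1 - w q^M) = Σ_b 2 w^b q^(M (b + 1))
factorTail : ℕ → Series
factorTail M a b = if a ≡ᵇ M * suc b then + 2 else + 0

+-≡ᵇ-*-suc : ∀ M r b → (M + r ≡ᵇ M * suc b) ≡ (r ≡ᵇ M * b)
+-≡ᵇ-*-suc M r b = trans (cong (M + r ≡ᵇ_) (*-suc M b)) (+-≡ᵇ M r (M * b))

<-≡ᵇ-*-suc : ∀ {M a} b → a < M → (a ≡ᵇ M * suc b) ≡ false
<-≡ᵇ-*-suc {M} b a<M = ≢⇒≡ᵇ-false λ a≡ → <⇒≱ a<M (subst (M ≤_) (sym a≡) (m≤m*n M (suc b)))

denFactor-zeroʳ : ∀ M a → denFactor M a 0 ≡ oneS a 0
denFactor-zeroʳ M zero    rewrite *-zeroʳ M = refl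
denFactor-zeroʳ M (suc a) rewrite *-zeroʳ M = refl

denFactor-< : ∀ {M a} b → a < M → denFactor M a b ≡ oneS a b
denFactor-< {M} {a}     zero    _   = denFactor-zeroʳ M a
denFactor-< {M} {zero}  (suc b) a<M rewrite <-≡ᵇ-*-suc b a<M = refl
denFactor-< {M} {suc a} (suc b) a<M rewrite <-≡ᵇ-*-suc b a<M = refl

denFactor-unfold : ∀ N′ → denFactor (suc N′) ≐ oneS ⊕ shift (suc N′) 1 (denFactor (suc N′))
denFactor-unfold N′ a b with suc N′ ≤? a | 1 ≤? b
... | no M≰a  | _ = trans (denFactor-< b (≰⇒> M≰a)) (sym (ℤ.+-identityʳ (oneS a b)))
denFactor-unfold N′ a zero    | yes _ | no _ =
  trans (denFactor-zeroʳ (suc N′) a) (sym (ℤ.+-identityʳ (oneS a 0)))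
denFactor-unfold N′ a (suc b) | yes _ | no 1≰b = ⊥-elim (1≰b (s≤s z≤n))
denFactor-unfold N′ a (suc b) | yes M≤a | yes _ with m≤n⇒∃[o]m+o≡n M≤a
... | r , refl rewrite m+n∸m≡n (suc N′) r | +-≡ᵇ-*-suc (suc N′) r b = sym (ℤ.+-identityˡ _)

factorTail-shift : ∀ N′ →
  factorTail (suc N′) ≐ λ a b → + 2 *ℤ shift (suc N′) 0 (denFactor (suc N′)) a b
factorTail-shift N′ a b with suc N′ ≤? a | 0 ≤? b
... | no M≰a  | _      rewrite <-≡ᵇ-*-suc b (≰⇒> M≰a) = refl
... | yes _   | no 0≰b = ⊥-elim (0≰b z≤n)
... | yes M≤a | yes _  with m≤n⇒∃[o]m+o≡n M≤a
... | r , refl rewrite m+n∸m≡n (suc N′) r | +-≡ᵇ-*-suc (suc N′) r b =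
  sym (if-float (+ 2 *ℤ_) (r ≡ᵇ suc N′ * b))

-- With G = denFactor M = 1 + w q^M G, the term - w q^M G of the numerator cancels.
factor-split : ∀ N′ → numFactor (suc N′) ⊛ denFactor (suc N′) ≐ oneS ⊕ factorTail (suc N′)
factor-split N′ a b = begin
  (numFactor M ⊛ den) a b
    ≡⟨ ⊛-congˡ den (numFactor-monomials N′) a b ⟩
  ((m₀ ⊕ m₁ ⊕ m₂) ⊛ den) a b
    ≡⟨ ⊛-distribʳ-⊕ den (m₀ ⊕ m₁) m₂ a b ⟩
  ((m₀ ⊕ m₁) ⊛ den) a b +ℤ (m₂ ⊛ den) a b
    ≡⟨ cong (_+ℤ (m₂ ⊛ den) a b) (⊛-distribʳ-⊕ den m₀ m₁ a b) ⟩
  (m₀ ⊛ den) a b +ℤ (m₁ ⊛ den) a b +ℤ (m₂ ⊛ den) a b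
    ≡⟨ cong₂ _+ℤ_ (cong₂ _+ℤ_ (monomial-⊛ 0 0 (+ 1) den a b) (monomial-⊛ M 0 (+ 2) den a b))
                  (monomial-⊛ M 1 (- + 1) den a b) ⟩
  + 1 *ℤ den a b +ℤ + 2 *ℤ shift M 0 den a b +ℤ - + 1 *ℤ shift M 1 den a b
    ≡⟨ cong₂ (λ d t → + 1 *ℤ d +ℤ t +ℤ - + 1 *ℤ shift M 1 den a b)
             (denFactor-unfold N′ a b) (sym (factorTail-shift N′ a b)) ⟩
  + 1 *ℤ (oneS a b +ℤ shift M 1 den a b) +ℤ factorTail M a b +ℤ - + 1 *ℤ shift M 1 den a b
    ≡⟨ cancel (oneS a b) (shift M 1 den a b) (factorTail M a b) ⟩
  oneS a b +ℤ factorTail M a b ∎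
  where
  open ≡-Reasoning
  M   = suc N′
  den = denFactor M
  m₀  = monomial 0 0 (+ 1)
  m₁  = monomial M 0 (+ 2)
  m₂  = monomial M 1 (- + 1)
  cancel : ∀ o s t → + 1 *ℤ (o +ℤ s) +ℤ t +ℤ - + 1 *ℤ s ≡ o +ℤ t
  cancel = solve-∀

⊛-factorTail : ∀ M R n m → (R ⊛ factorTail M) n m ≡
  sumTo m (λ j → if does (M * suc (m ∸ j) ≤? n) then + 2 *ℤ R (n ∸ M * suc (m ∸ j)) j else + 0)
⊛-factorTail M R n m =
  trans (sumTo-swap n m _) (sumTo-cong m λ j _ → column j (M * suc (m ∸ j)) (M * suc (m ∸ j) ≤? n))
  where
  off : ∀ i j c → n ∸ i ≢ c → R i j *ℤ (if n ∸ i ≡ᵇ c then + 2 else + 0) ≡ + 0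
  off i j c n∸i≢c rewrite ≢⇒≡ᵇ-false n∸i≢c = ℤ.*-zeroʳ (R i j)

  column : ∀ j c (c≤?n : Dec (c ≤ n)) → sumTo n (λ i → R i j *ℤ (if n ∸ i ≡ᵇ c then + 2 else + 0))
                                        ≡ (if does c≤?n then + 2 *ℤ R (n ∸ c) j else + 0)
  column j c (no c≰n)  =
    sumTo-zero n λ i _ → off i j c λ n∸i≡c → c≰n (subst (_≤ n) n∸i≡c (m∸n≤m n i))
  column j c (yes c≤n) = begin
    sumTo n (λ i → R i j *ℤ (if n ∸ i ≡ᵇ c then + 2 else + 0))
      ≡⟨ sumTo-single n (m∸n≤m n c) (λ i i≤n i≢n∸c →
           off i j c λ n∸i≡c → i≢n∸c (trans (sym (m∸[m∸n]≡n i≤n)) (cong (n ∸_) n∸i≡c))) ⟩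
    R (n ∸ c) j *ℤ (if n ∸ (n ∸ c) ≡ᵇ c then + 2 else + 0)
      ≡⟨ cong (λ β → R (n ∸ c) j *ℤ (if β then + 2 else + 0))
              (trans (cong (_≡ᵇ c) (m∸[m∸n]≡n c≤n)) (≡ᵇ-refl c)) ⟩
    R (n ∸ c) j *ℤ + 2
      ≡⟨ ℤ.*-comm (R (n ∸ c) j) (+ 2) ⟩
    + 2 *ℤ R (n ∸ c) j ∎
    where open ≡-Reasoning

-- Partial products

countExactly-sumTo : ∀ count N′ k n m →
  + countExactly count N′ k n m ≡ sumTo m (λ j → + countStripped count N′ (k + (m ∸ j)) n j)
countExactly-sumTo count N′ k n zero    =
  cong (λ k′ → + countStripped count N′ k′ n 0) (sym (+-identityʳ k))
countExactly-sumTo count N′ k n (suc m) = cong₂ _+ℤ_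
  (trans (countExactly-sumTo count N′ (suc k) n m) (sumTo-cong m λ j j≤m → cong (term j) (reindex j≤m)))
  (cong (term (suc m)) (sym (trans (cong (_+_ k) (n∸n≡0 m)) (+-identityʳ k))))
  where
  term : ℕ → ℕ → ℤ
  term j k′ = + countStripped count N′ k′ n j
  reindex : ∀ {j} → j ≤ m → suc k + (m ∸ j) ≡ k + (suc m ∸ j)
  reindex {j} j≤m = sym (trans (cong (_+_ k) (+-∸-assoc 1 j≤m)) (+-suc k (m ∸ j)))

column-countStripped : ∀ N′ count R → R ≐ (λ a b → + count a b) → ∀ s n j →
  (if does (suc N′ * s ≤? n) then + 2 *ℤ R (n ∸ suc N′ * s) j else + 0) ≡ + countStripped count N′ s n j
column-countStripped N′ count R R≐count s n j =
  trans (cong (λ d → if does (d ≤? n) then + 2 *ℤ R (n ∸ d) j else + 0) (*-comm (suc N′) s))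
        (by-cases (s * suc N′ ≤? n))
  where
  by-cases : (d : Dec (s * suc N′ ≤ n)) →
             (if does d then + 2 *ℤ R (n ∸ s * suc N′) j else + 0)
             ≡ + (if does d then 2 * count (n ∸ s * suc N′) j else 0)
  by-cases (yes _) = trans (cong (+ 2 *ℤ_) (R≐count _ j)) (sym (ℤ.pos-* 2 (count (n ∸ s * suc N′) j)))
  by-cases (no _)  = refl

rhsPartial-countAtMost : ∀ N n m → rhsPartial N n m ≡ + countAtMost N n m
rhsPartial-countAtMost zero     zero    zero    = refl
rhsPartial-countAtMost zero     zero    (suc m) = refl
rhsPartial-countAtMost zero     (suc n) m       = refl
rhsPartial-countAtMost (suc N′) n       m       = begin
  (R ⊛ (numFactor M ⊛ denFactor M)) n m
    ≡⟨ ⊛-congʳ R (factor-split N′) n m ⟩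
  (R ⊛ (oneS ⊕ factorTail M)) n m
    ≡⟨ ⊛-distribˡ-⊕ R oneS (factorTail M) n m ⟩
  (R ⊛ oneS) n m +ℤ (R ⊛ factorTail M) n m
    ≡⟨ cong₂ _+ℤ_ (⊛-identityʳ R n m) (⊛-factorTail M R n m) ⟩
  R n m +ℤ sumTo m (λ j → if does (M * suc (m ∸ j) ≤? n) then + 2 *ℤ R (n ∸ M * suc (m ∸ j)) j else + 0)
    ≡⟨ cong₂ _+ℤ_ (rhsPartial-countAtMost N′ n m) (sumTo-cong m λ j _ →
         column-countStripped N′ (countAtMost N′) R (rhsPartial-countAtMost N′) (suc (m ∸ j)) n j) ⟩
  + countAtMost N′ n m +ℤ sumTo m (λ j → + countStripped (countAtMost N′) N′ (1 + (m ∸ j)) n j)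
    ≡⟨ cong (+ countAtMost N′ n m +ℤ_) (countExactly-sumTo (countAtMost N′) N′ 1 n m) ⟨
  + countAtMost (suc N′) n m ∎
  where
  open ≡-Reasoning
  M = suc N′
  R = rhsPartial N′

OverPartition↔Fin : ∀ {N n m} → n ≤ N → OverPartition n m ↔ Fin (countAtMost N n m)
OverPartition↔Fin {N} {n} {m} n≤N = ↔-trans (OverPartition↔AtMost n≤N) (AtMost↔Fin N n m)

corollary3p2 : (n m : ℕ) →
    Σ ℕ λ k → (OverPartition n m ↔ Fin k) ×
      ((N : ℕ) → n ≤ N → rhsPartial N n m ≡ + k)
corollary3p2 n m = countAtMost n n m , OverPartition↔Fin ≤-refl , λ N n≤N → begin
  rhsPartial N n m     ≡⟨ rhsPartial-countAtMost N n m ⟩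
  + countAtMost N n m
    ≡⟨ cong +_ (↔⇒≡ (↔-trans (↔-sym (OverPartition↔Fin n≤N)) (OverPartition↔Fin ≤-refl))) ⟩
  + countAtMost n n m  ∎
  where open ≡-Reasoning
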